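{- For every integer $k\ge 2$, the bipartite graph $D_k$ is an ACB graph with $\nabla_{D_k}(X)=\nabla_{D_k}(Y)=k$.
   Context: For $k\ge2$, $D_k=(X,Y,E)$ is the bipartite graph with $X=\{x_1,\dots,x_{3k-4}\}$, $Y=\{y_1,\dots,y_{3k-4}\}$, where $x_iy_j$ is an edge iff $|i-j|\le k-2$ and $\{i,j\}\cap\{k-1,\dots,2k-2\}\neq\emptyset$. For a bipartite graph $B=(X,Y,E)$ with color classes $X,Y$: the mirror $mir(B)$ has the same color classes and $xy$ ($x\in X$, $y\in Y$) is an edge iff it is not an edge of $B$; $B$ is chordal bipartite if it has no induced chordless cycle $C_{2k}$, $k\ge3$; $B$ is ACB if both $B$ and $mir(B)$ are chordal bipartite. $\nabla_B(X)$ is the maximum number of vertices of $X$ whose neighborhoods $N(x)$ are pairwise incomparable with respect to set inclusion (two equal neighborhoods count as comparable); $\nabla_B(Y)$ is defined analogously. -}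

module Defs where

open import Data.Nat using (ℕ; zero; suc; _+_; _*_; _∸_; _≤_; _≤ᵇ_; ∣_-_∣)
open import Data.Nat.DivMod using (_%_)
open import Data.Fin using (Fin; toℕ)
open import Data.Bool using (Bool; true; false; not; _∧_; _∨_)
open import Data.Product using (Σ; _×_)
open import Data.Sum using (_⊎_)
open import Relation.Binary.PropositionalEquality using (_≡_; _≢_)
open import Relation.Nullary using (¬_)
open import Function.Definitions using (Injective)

record BGraph : Set where
  field
    nX : ℕ
    nY : ℕ
    E  : Fin nX → Fin nY → Bool
open BGraph public

mir : BGraph → BGraph
mir B = record { nX = nX B ; nY = nY B ; E = λ x y → not (E B x y) }

swap : BGraph → BGraph
swap B = record { nX = nY B ; nY = nX B ; E = λ y x → E B x y }

-- Induced chordless cycle of length 2(j+3) (i.e. C_{2k}, k = j+3 ≥ 3):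
-- distinct x_0..x_{k-1} ∈ X, distinct y_0..y_{k-1} ∈ Y such that x_i y_l is
-- an edge iff l = i or l = i+1 (mod k).  This is exactly the cycle
-- x_0 y_1 x_1 y_2 ... x_{k-1} y_0 x_0 with no further edges among its vertices.
InducedCycle : (B : BGraph) (j : ℕ) → Set
InducedCycle B j =
  Σ (Fin (3 + j) → Fin (nX B)) λ xs →
  Σ (Fin (3 + j) → Fin (nY B)) λ ys →
    Injective _≡_ _≡_ xs × Injective _≡_ _≡_ ys ×
    (∀ i l → (E B (xs i) (ys l) ≡ true) →
        (l ≡ i) ⊎ (toℕ l ≡ suc (toℕ i) % (3 + j)))
    × (∀ i l → ((l ≡ i) ⊎ (toℕ l ≡ suc (toℕ i) % (3 + j))) →
        E B (xs i) (ys l) ≡ true)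

ChordalBipartite : BGraph → Set
ChordalBipartite B = ∀ j → ¬ InducedCycle B j

ACB : BGraph → Set
ACB B = ChordalBipartite B × ChordalBipartite (mir B)

NSub : (B : BGraph) → Fin (nX B) → Fin (nX B) → Set
NSub B x x' = ∀ y → E B x y ≡ true → E B x' y ≡ true

-- A family of t distinct vertices of X with pairwise incomparable
-- neighbourhoods (equal neighbourhoods count as comparable).
IncomparableX : (B : BGraph) (t : ℕ) → (Fin t → Fin (nX B)) → Set
IncomparableX B t f =
  Injective _≡_ _≡_ f × (∀ a b → a ≢ b → ¬ NSub B (f a) (f b))

NablaX≡ : BGraph → ℕ → Set
NablaX≡ B t =
  (Σ (Fin t → Fin (nX B)) λ f → IncomparableX B t f) ×
  (∀ s (f : Fin s → Fin (nX B)) → IncomparableX B s f → s ≤ t)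

NablaY≡ : BGraph → ℕ → Set
NablaY≡ B t = NablaX≡ (swap B) t

-- The graph D_k: X = {x_1..x_{3k-4}}, Y = {y_1..y_{3k-4}}; vertex x_i is
-- represented by a : Fin (3k-4) with i = toℕ a + 1.
-- x_i y_j is an edge iff |i-j| ≤ k-2 and {i,j} ∩ {k-1,…,2k-2} ≠ ∅.
inMid : ℕ → ℕ → Bool
inMid k i = (k ∸ 1 ≤ᵇ i) ∧ (i ≤ᵇ 2 * k ∸ 2)

D : ℕ → BGraph
D k = record
  { nX = 3 * k ∸ 4
  ; nY = 3 * k ∸ 4
  ; E  = λ a b →
      let i = suc (toℕ a) ; j = suc (toℕ b) in
      (∣ i - j ∣ ≤ᵇ k ∸ 2) ∧ (inMid k i ∨ inMid k j)
  }

-- Write k = m + 2. Every neighbourhood of D_k is a block of consecutive y's. In a graph with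
-- this property there is no chordless cycle of length ≥ 6, and in its mirror none of length
-- ≥ 8: near the lowest y of the cycle some x would see two y's but not one lying between them.
-- An induced C₆ of mir(D_k) is an induced matching of size three in D_k, impossible because
-- every edge has an end in the middle block {k-1, …, 2k-2}, and two such ends on the same side
-- force an edge between the matching edges. The k middle vertices of X have pairwise
-- incomparable neighbourhoods, while the neighbourhoods of the vertices before the middle
-- block form a chain, as do those after it, so no larger incomparable family exists. Since
-- D_k is symmetric in X and Y, the same holds for Y.
module Submission where

open import Defs
open import Data.Bool using (Bool; true; false; _∧_)
open import Data.Bool.Properties using (∨-comm; not-injective; ¬-not)
open import Data.Empty using (⊥; ⊥-elim)
open import Data.Fin using (Fin; toℕ; fromℕ<; fromℕ; inject₁)
  renaming (zero to fzero; suc to fsuc; _≟_ to _≟ᶠ_)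
open import Data.Fin.Properties
  using (toℕ-injective; toℕ-fromℕ<; toℕ-fromℕ; toℕ-inject₁; toℕ<n; injective⇒≤)
open import Data.List.Base using (allFin)
open import Data.List.Extrema.Nat using (argmin; f[argmin]≤f[xs])
open import Data.List.Membership.Propositional.Properties using (∈-allFin)
import Data.List.Relation.Unary.All as All
open import Data.Nat
  using (ℕ; zero; suc; _+_; _*_; _∸_; _⊓_; _≤_; _<_; _≤ᵇ_; ∣_-_∣; NonZero; z≤n; s≤s; z<s; s<s;
         _≤?_; _<?_)
open import Data.Nat.DivMod
  using (_%_; m%n<n; %-distribˡ-+; m%n%n≡m%n; m<n⇒m%n≡m; n%n≡0; m≤n⇒[n∸m]%m≡n%m)
open import Data.Nat.GeneralisedArithmetic using (iterate)
open import Data.Nat.Properties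
open import Data.Nat.Tactic.RingSolver using (solve-∀)
open import Data.Product using (Σ; _×_; _,_; proj₁; proj₂; uncurry)
open import Data.Product.Function.NonDependent.Propositional using (_×-⇔_)
open import Data.Sum using (_⊎_; inj₁; inj₂; [_,_]′)
import Data.Sum as Sum
open import Function using (_∘_)
open import Function.Bundles using (_⇔_; mk⇔; Equivalence)
open import Function.Construct.Identity using (⇔-id)
open import Relation.Binary.Definitions using (tri<; tri≈; tri>)
open import Relation.Binary.PropositionalEquality
open import Relation.Nullary using (¬_; yes; no; contradiction)
open import Relation.Nullary.Reflects using (Reflects; ofʸ; ofⁿ; _×-reflects_; _⊎-reflects_)

true⇒reflected : ∀ {A : Set} {b} → Reflects A b → b ≡ true → A
true⇒reflected (ofʸ a) _ = a
true⇒reflected (ofⁿ _) ()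

reflected⇒true : ∀ {A : Set} {b} → Reflects A b → A → b ≡ true
reflected⇒true (ofʸ _) _ = refl
reflected⇒true (ofⁿ ¬a) a = contradiction a ¬a

false⇒¬reflected : ∀ {A : Set} {b} → Reflects A b → b ≡ false → ¬ A
false⇒¬reflected (ofⁿ ¬a) _ = ¬a
false⇒¬reflected (ofʸ _) ()

Reflects-⇔ : ∀ {A B : Set} {b} → A ⇔ B → Reflects A b → Reflects B b
Reflects-⇔ A⇔B (ofʸ a) = ofʸ (Equivalence.to A⇔B a)
Reflects-⇔ A⇔B (ofⁿ ¬a) = ofⁿ (¬a ∘ Equivalence.from A⇔B)

∣m-n∣≤o⇔ : ∀ m n o → ∣ m - n ∣ ≤ o ⇔ (m ≤ n + o × n ≤ m + o)
∣m-n∣≤o⇔ m n o = mk⇔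
  (λ d → bound m n d , bound n m (subst (_≤ o) (∣-∣-comm m n) d))
  (uncurry (join m n))
  where
  bound : ∀ m n → ∣ m - n ∣ ≤ o → m ≤ n + o
  bound zero    n       _ = z≤n
  bound (suc m) zero    d = d
  bound (suc m) (suc n) d = s≤s (bound m n d)
  join : ∀ m n → m ≤ n + o → n ≤ m + o → ∣ m - n ∣ ≤ o
  join zero    n       _       q       = q
  join (suc m) zero    p       _       = p
  join (suc m) (suc n) (s≤s p) (s≤s q) = join m n p q

m<n⇒o<n⇒m∸o<n∸o : ∀ {m n} o → m < n → o < n → m ∸ o < n ∸ o
m<n⇒o<n⇒m∸o<n∸o                 zero    m<n       _         = m<n
m<n⇒o<n⇒m∸o<n∸o {zero}          (suc o) _         o<n       = m<n⇒0<n∸m o<n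
m<n⇒o<n⇒m∸o<n∸o {suc m} {suc n} (suc o) (s<s m<n) (s<s o<n) = m<n⇒o<n⇒m∸o<n∸o o m<n o<n

[m+n%o]%o≡[m+n]%o : ∀ m n o .{{_ : NonZero o}} → (m + n % o) % o ≡ (m + n) % o
[m+n%o]%o≡[m+n]%o m n o = begin
  (m + n % o) % o          ≡⟨ %-distribˡ-+ m (n % o) o ⟩
  (m % o + n % o % o) % o  ≡⟨ cong (λ r → (m % o + r) % o) (m%n%n≡m%n n o) ⟩
  (m % o + n % o) % o      ≡⟨ %-distribˡ-+ m n o ⟨
  (m + n) % o              ∎
  where open ≡-Reasoning

[r+m]%n≢m : ∀ {r m n} .{{_ : NonZero n}} → 0 < r → r < n → m < n → (r + m) % n ≢ m
[r+m]%n≢m {r} {m} {n} 0<r r<n m<n eq with r + m <? n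
... | yes r+m<n = <⇒≢ 0<r (sym (+-cancelʳ-≡ m r 0 (trans (sym (m<n⇒m%n≡m r+m<n)) eq)))
... | no r+m≮n = <⇒≢ r<n (+-cancelʳ-≡ m r n (begin
  r + m            ≡⟨ m∸n+n≡m n≤r+m ⟨
  r + m ∸ n + n    ≡⟨ cong (_+ n) wrapped ⟩
  m + n            ≡⟨ +-comm m n ⟩
  n + m            ∎))
  where
  open ≡-Reasoning
  n≤r+m : n ≤ r + m
  n≤r+m = ≮⇒≥ r+m≮n
  wrapped : r + m ∸ n ≡ m
  wrapped = begin
    r + m ∸ n        ≡⟨ m<n⇒m%n≡m (m<n+o⇒m∸n<o (r + m) n (+-mono-< r<n m<n)) ⟨
    (r + m ∸ n) % n  ≡⟨ m≤n⇒[n∸m]%m≡n%m n≤r+m ⟩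
    (r + m) % n      ≡⟨ eq ⟩
    m                ∎

Fin-argmin : ∀ {n} (f : Fin (suc n) → ℕ) → Σ (Fin (suc n)) λ t → ∀ i → f t ≤ f i
Fin-argmin f = argmin f fzero (allFin _) ,
  λ i → All.lookup (f[argmin]≤f[xs] {f = f} fzero (allFin _)) (∈-allFin i)

module CyclicOrder (j : ℕ) where

  next : Fin (3 + j) → Fin (3 + j)
  next i = fromℕ< (m%n<n (suc (toℕ i)) (3 + j))

  toℕ-next : ∀ i → toℕ (next i) ≡ suc (toℕ i) % (3 + j)
  toℕ-next i = toℕ-fromℕ< _

  toℕ-iterate-next : ∀ r i → toℕ (iterate next i r) ≡ (r + toℕ i) % (3 + j)
  toℕ-iterate-next zero    i = sym (m<n⇒m%n≡m (toℕ<n i))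
  toℕ-iterate-next (suc r) i = begin
    toℕ (iterate next (next i) r)          ≡⟨ toℕ-iterate-next r (next i) ⟩
    (r + toℕ (next i)) % (3 + j)           ≡⟨ cong (λ t → (r + t) % (3 + j)) (toℕ-next i) ⟩
    (r + suc (toℕ i) % (3 + j)) % (3 + j)  ≡⟨ [m+n%o]%o≡[m+n]%o r (suc (toℕ i)) (3 + j) ⟩
    (r + suc (toℕ i)) % (3 + j)            ≡⟨ cong (_% (3 + j)) (+-suc r (toℕ i)) ⟩
    (suc r + toℕ i) % (3 + j)              ∎
    where open ≡-Reasoning

  iterate-next-≢ : ∀ {r} i → 0 < r → r < 3 + j → iterate next i r ≢ i
  iterate-next-≢ {r} i 0<r r<3+j eq =
    [r+m]%n≢m 0<r r<3+j (toℕ<n i) (trans (sym (toℕ-iterate-next r i)) (cong toℕ eq))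

  next-≢ : ∀ i → next i ≢ i
  next-≢ i = iterate-next-≢ {1} i z<s (s<s z<s)

  next²-≢ : ∀ i → next (next i) ≢ i
  next²-≢ i = iterate-next-≢ {2} i z<s (s<s (s<s z<s))

  prev : Fin (3 + j) → Fin (3 + j)
  prev fzero    = fromℕ (2 + j)
  prev (fsuc i) = inject₁ i

  next-prev : ∀ i → next (prev i) ≡ i
  next-prev fzero = toℕ-injective (begin
    toℕ (next (fromℕ (2 + j)))           ≡⟨ toℕ-next (fromℕ (2 + j)) ⟩
    suc (toℕ (fromℕ (2 + j))) % (3 + j)  ≡⟨ cong (λ t → suc t % (3 + j)) (toℕ-fromℕ (2 + j)) ⟩
    (3 + j) % (3 + j)                    ≡⟨ n%n≡0 (3 + j) ⟩
    0                                    ∎)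
    where open ≡-Reasoning
  next-prev (fsuc i) = toℕ-injective (begin
    toℕ (next (inject₁ i))               ≡⟨ toℕ-next (inject₁ i) ⟩
    suc (toℕ (inject₁ i)) % (3 + j)      ≡⟨ cong (λ t → suc t % (3 + j)) (toℕ-inject₁ i) ⟩
    suc (toℕ i) % (3 + j)                ≡⟨ m<n⇒m%n≡m (toℕ<n (fsuc i)) ⟩
    suc (toℕ i)                          ∎)
    where open ≡-Reasoning

module InducedCycleFacts (B : BGraph) {j : ℕ} (cycle : InducedCycle B j) where
  open CyclicOrder j public

  xs : Fin (3 + j) → Fin (nX B)
  xs = proj₁ cycle

  ys : Fin (3 + j) → Fin (nY B)
  ys = proj₁ (proj₂ cycle)

  private
    chordless : ∀ i l → E B (xs i) (ys l) ≡ true → (l ≡ i) ⊎ (toℕ l ≡ suc (toℕ i) % (3 + j))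
    chordless = proj₁ (proj₂ (proj₂ (proj₂ (proj₂ cycle))))

    cycle-edge : ∀ i l → (l ≡ i) ⊎ (toℕ l ≡ suc (toℕ i) % (3 + j)) → E B (xs i) (ys l) ≡ true
    cycle-edge = proj₂ (proj₂ (proj₂ (proj₂ (proj₂ cycle))))

  edge-here : ∀ i → E B (xs i) (ys i) ≡ true
  edge-here i = cycle-edge i i (inj₁ refl)

  edge-next : ∀ i → E B (xs i) (ys (next i)) ≡ true
  edge-next i = cycle-edge i (next i) (inj₂ (toℕ-next i))

  non-edge : ∀ {i l} → l ≢ i → l ≢ next i → E B (xs i) (ys l) ≡ false
  non-edge {i} {l} l≢i l≢next = ¬-not λ e →
    [ l≢i , (λ eq → l≢next (toℕ-injective (trans eq (sym (toℕ-next i))))) ]′ (chordless i l e)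

ConvexY : BGraph → Set
ConvexY B = ∀ x {y₁ y₂ y₃} → toℕ y₁ ≤ toℕ y₂ → toℕ y₂ ≤ toℕ y₃ →
            E B x y₁ ≡ true → E B x y₃ ≡ true → E B x y₂ ≡ true

module _ {B : BGraph} (convex : ConvexY B) where

  private
    no-gap : ∀ {x y₁ y₂ y₃} → toℕ y₁ ≤ toℕ y₂ → toℕ y₂ ≤ toℕ y₃ →
             E B x y₁ ≡ true → E B x y₃ ≡ true → E B x y₂ ≡ false → ⊥
    no-gap {x} y₁≤y₂ y₂≤y₃ e₁ e₃ e₂ with trans (sym (convex x y₁≤y₂ y₂≤y₃ e₁ e₃)) e₂
    ... | ()

  -- y_q is the lowest vertex of the cycle and the lower of y_p, y_r lies between y_q and the
  -- other, yet x_q misses y_p and x_p misses y_r.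
  convex⇒chordalBipartite : ChordalBipartite B
  convex⇒chordalBipartite j cycle = [ via-q , via-p ]′ (≤-total (y p) (y r))
    where
    open InducedCycleFacts B cycle
    y : Fin (3 + j) → ℕ
    y i = toℕ (ys i)
    t p q r : Fin (3 + j)
    t = proj₁ (Fin-argmin y)
    p = prev t
    q = next p
    r = next q
    q-lowest : ∀ i → y q ≤ y i
    q-lowest i = subst (λ s → y s ≤ y i) (sym (next-prev t)) (proj₂ (Fin-argmin y) i)
    via-q : y p ≤ y r → ⊥
    via-q p≤r = no-gap (q-lowest p) p≤r (edge-here q) (edge-next q)
      (non-edge (next-≢ p ∘ sym) (next²-≢ p ∘ sym))
    via-p : y r ≤ y p → ⊥
    via-p r≤p = no-gap (q-lowest r) r≤p (edge-next p) (edge-here p)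
      (non-edge (next²-≢ p) (next-≢ q))

  -- y_a is the lowest vertex of the cycle; in B, x_b misses y_b but sees y_a and y_d, while x_c
  -- misses y_d but sees y_a and y_b.
  convex⇒mir-has-no-long-cycle : ∀ j → ¬ InducedCycle (mir B) (suc j)
  convex⇒mir-has-no-long-cycle j cycle = [ via-b , via-c ]′ (≤-total (y b) (y d))
    where
    open InducedCycleFacts (mir B) cycle
    y : Fin (4 + j) → ℕ
    y i = toℕ (ys i)
    a b c d : Fin (4 + j)
    a = proj₁ (Fin-argmin y)
    b = next a
    c = next b
    d = next c
    a-lowest : ∀ i → y a ≤ y i
    a-lowest = proj₂ (Fin-argmin y)
    edge : ∀ {i l} → l ≢ i → l ≢ next i → E B (xs i) (ys l) ≡ true
    edge l≢i l≢next = not-injective {y = true} (non-edge l≢i l≢next)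
    via-b : y b ≤ y d → ⊥
    via-b b≤d = no-gap (a-lowest b) b≤d
      (edge (next-≢ a ∘ sym) (next²-≢ a ∘ sym)) (edge (next²-≢ b) (next-≢ c))
      (not-injective {y = false} (edge-here b))
    via-c : y d ≤ y b → ⊥
    via-c d≤b = no-gap (a-lowest d) d≤b
      (edge (next²-≢ a ∘ sym) (iterate-next-≢ {3} a z<s (s<s (s<s (s<s z<s))) ∘ sym))
      (edge (next-≢ b ∘ sym) (next²-≢ b ∘ sym))
      (not-injective {y = false} (edge-next c))

NSub-cong : ∀ {p q} {F G : Fin p → Fin q → Bool} {x x'} → (∀ x y → F x y ≡ G x y) →
            NSub (record { nX = p ; nY = q ; E = F }) x x' →
            NSub (record { nX = p ; nY = q ; E = G }) x x'
NSub-cong {x = x} {x'} F≗G sub y e = trans (sym (F≗G x' y)) (sub y (trans (F≗G x y) e))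

NablaX≡-cong : ∀ {p q t} {F G : Fin p → Fin q → Bool} → (∀ x y → F x y ≡ G x y) →
               NablaX≡ (record { nX = p ; nY = q ; E = F }) t →
               NablaX≡ (record { nX = p ; nY = q ; E = G }) t
NablaX≡-cong F≗G ((f , f-injective , f-incomparable) , bound) =
  (f , f-injective , λ a b a≢b → f-incomparable a b a≢b ∘ NSub-cong (λ x y → sym (F≗G x y))) ,
  λ s g (g-injective , g-incomparable) →
    bound s g (g-injective , λ a b a≢b → g-incomparable a b a≢b ∘ NSub-cong F≗G)

Top : ℕ → ℕ
Top m = 2 + (m + m)

-- With k = m + 2, `Mid m i` says that i ∈ {k-1, …, 2k-2}, and `Adj m i j` says that
-- x_i y_j is an edge of D_k.
Mid : ℕ → ℕ → Set
Mid m i = suc m ≤ i × i ≤ Top m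

Near : ℕ → ℕ → ℕ → Set
Near m i j = i ≤ j + m × j ≤ i + m

Adj : ℕ → ℕ → ℕ → Set
Adj m i j = Near m i j × (Mid m i ⊎ Mid m j)

1+m<Top : ∀ m → suc m < Top m
1+m<Top m = s≤s (s≤s (m≤m+n m m))

Adj-sym : ∀ {m i j} → Adj m i j → Adj m j i
Adj-sym ((i≤ , j≤) , mid) = (j≤ , i≤) , Sum.swap mid

Adj-refl : ∀ {m i} → Mid m i → Adj m i i
Adj-refl {m} {i} mi = (m≤m+n i m , m≤m+n i m) , inj₁ mi

Adj-convex : ∀ {m i j₁ j₂ j₃} → Adj m i j₁ → Adj m i j₃ → j₁ ≤ j₂ → j₂ ≤ j₃ → Adj m i j₂
Adj-convex {m} {i} {j₁} {j₂} {j₃} ((i≤j₁+m , _) , mid₁) ((_ , j₃≤i+m) , mid₃) j₁≤j₂ j₂≤j₃ =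
  (≤-trans i≤j₁+m (+-monoˡ-≤ m j₁≤j₂) , ≤-trans j₂≤j₃ j₃≤i+m) , middle mid₁ mid₃
  where
  middle : Mid m i ⊎ Mid m j₁ → Mid m i ⊎ Mid m j₃ → Mid m i ⊎ Mid m j₂
  middle (inj₁ mi)           _                  = inj₁ mi
  middle (inj₂ _)            (inj₁ mi)          = inj₁ mi
  middle (inj₂ (m<j₁ , _))   (inj₂ (_ , j₃≤T))  = inj₂ (≤-trans m<j₁ j₁≤j₂ , ≤-trans j₂≤j₃ j₃≤T)

middle-non-neighbour : ∀ {m a b} → Mid m a → ¬ Adj m a b → b + m < a ⊎ a + m < b
middle-non-neighbour {m} {a} {b} ma ¬ab with a ≤? b + m | b ≤? a + m
... | yes a≤b+m | yes b≤a+m = contradiction ((a≤b+m , b≤a+m) , inj₁ ma) ¬ab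
... | no a≰b+m  | _         = inj₁ (≰⇒> a≰b+m)
... | yes _     | no b≰a+m  = inj₂ (≰⇒> b≰a+m)

left-of-middle : ∀ {m a b} → Mid m a → b + m < a → b ≤ suc m
left-of-middle {m} {a} {b} (_ , a≤T) b+m<a = +-cancelʳ-≤ m b (suc m) (≤-pred (≤-trans b+m<a a≤T))

right-of-middle : ∀ {m a b} → Mid m a → a + m < b → Top m ≤ b
right-of-middle {m} (m<a , _) a+m<b = ≤-trans (s≤s (+-monoˡ-≤ m m<a)) a+m<b

Unlinked : ℕ → ℕ × ℕ → ℕ × ℕ → Set
Unlinked m (a , b) (a' , b') = ¬ Adj m a b' × ¬ Adj m a' b

InducedMatching₃ : ℕ → (e₀ e₁ e₂ : ℕ × ℕ) → Set
InducedMatching₃ m e₀ e₁ e₂ =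
  (uncurry (Adj m) e₀ × uncurry (Adj m) e₁ × uncurry (Adj m) e₂) ×
  Unlinked m e₀ e₁ × Unlinked m e₀ e₂ × Unlinked m e₁ e₂

InducedMatching₃-swap₀₁ : ∀ {m e₀ e₁ e₂} → InducedMatching₃ m e₀ e₁ e₂ → InducedMatching₃ m e₁ e₀ e₂
InducedMatching₃-swap₀₁ ((A₀ , A₁ , A₂) , (u , v) , U₀₂ , U₁₂) =
  (A₁ , A₀ , A₂) , (v , u) , U₁₂ , U₀₂

InducedMatching₃-swap₁₂ : ∀ {m e₀ e₁ e₂} → InducedMatching₃ m e₀ e₁ e₂ → InducedMatching₃ m e₀ e₂ e₁
InducedMatching₃-swap₁₂ ((A₀ , A₁ , A₂) , U₀₁ , U₀₂ , (u , v)) =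
  (A₀ , A₂ , A₁) , U₀₂ , U₀₁ , (v , u)

InducedMatching₃-rotate : ∀ {m e₀ e₁ e₂} → InducedMatching₃ m e₀ e₁ e₂ → InducedMatching₃ m e₁ e₂ e₀
InducedMatching₃-rotate = InducedMatching₃-swap₁₂ ∘ InducedMatching₃-swap₀₁

InducedMatching₃-transpose : ∀ {m a₀ b₀ a₁ b₁ a₂ b₂} →
  InducedMatching₃ m (a₀ , b₀) (a₁ , b₁) (a₂ , b₂) →
  InducedMatching₃ m (b₀ , a₀) (b₁ , a₁) (b₂ , a₂)
InducedMatching₃-transpose ((A₀ , A₁ , A₂) , U₀₁ , U₀₂ , U₁₂) =
  (Adj-sym A₀ , Adj-sym A₁ , Adj-sym A₂) , transpose U₀₁ , transpose U₀₂ , transpose U₁₂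
  where
  transpose : ∀ {m a b a' b'} → Unlinked m (a , b) (a' , b') → Unlinked m (b , a) (b' , a')
  transpose (¬ab' , ¬a'b) = ¬a'b ∘ Adj-sym , ¬ab' ∘ Adj-sym

-- b lies left of the middle and b' right of it; b'' lies beyond one of them, so it is not in
-- the middle, hence a'' is, and then a'' also sees b or b'.
ordered-middle-pair : ∀ {m a b a' b' a'' b''} → Mid m a → Mid m a' → a < a' →
                      ¬ InducedMatching₃ m (a , b) (a' , b') (a'' , b'')
ordered-middle-pair {m} {a} {b} {a'} {b'} {a''} {b''} ma ma' a<a'
  ((((a≤b+m , b≤a+m) , _) , ((a'≤b'+m , b'≤a'+m) , _) , a''b''@(_ , mid'')) ,
   (¬ab' , ¬a'b) , (¬ab'' , ¬a''b) , (¬a'b'' , ¬a''b'))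
  = [ below-b , above-b' ]′ b''-outside
  where
  b≤1+m : b ≤ suc m
  b≤1+m with middle-non-neighbour ma' ¬a'b
  ... | inj₁ b+m<a' = left-of-middle ma' b+m<a'
  ... | inj₂ a'+m<b = contradiction (≤-trans b≤a+m (+-monoˡ-≤ m (<⇒≤ a<a'))) (<⇒≱ a'+m<b)
  Top≤b' : Top m ≤ b'
  Top≤b' with middle-non-neighbour ma ¬ab'
  ... | inj₁ b'+m<a = contradiction (≤-trans (<⇒≤ a<a') a'≤b'+m) (<⇒≱ b'+m<a)
  ... | inj₂ a+m<b' = right-of-middle ma a+m<b'
  b''-outside : b'' < b ⊎ b' < b''
  b''-outside with middle-non-neighbour ma ¬ab''
  ... | inj₁ b''+m<a = inj₁ (+-cancelʳ-< m b'' b (<-≤-trans b''+m<a a≤b+m))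
  ... | inj₂ a+m<b'' with middle-non-neighbour ma' ¬a'b''
  ...   | inj₁ b''+m<a' = contradiction
          (≤-trans (right-of-middle ma a+m<b'') (left-of-middle ma' b''+m<a')) (<⇒≱ (1+m<Top m))
  ...   | inj₂ a'+m<b'' = inj₂ (≤-<-trans b'≤a'+m a'+m<b'')
  a''-middle : ¬ Mid m b'' → Mid m a''
  a''-middle ¬mb'' = [ (λ ma'' → ma'') , (λ mb'' → contradiction mb'' ¬mb'') ]′ mid''
  below-b : b'' < b → ⊥
  below-b b''<b = ¬a''b (Adj-convex a''b'' (Adj-refl ma'') (<⇒≤ b''<b) (≤-trans b≤1+m (proj₁ ma'')))
    where
    ma'' : Mid m a''
    ma'' = a''-middle λ (1+m≤b'' , _) → <⇒≱ (<-≤-trans b''<b b≤1+m) 1+m≤b''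
  above-b' : b' < b'' → ⊥
  above-b' b'<b'' =
    ¬a''b' (Adj-convex (Adj-refl ma'') a''b'' (≤-trans (proj₂ ma'') Top≤b') (<⇒≤ b'<b''))
    where
    ma'' : Mid m a''
    ma'' = a''-middle λ (_ , b''≤T) → <⇒≱ (≤-<-trans Top≤b' b'<b'') b''≤T

middle-pair-left : ∀ {m a b a' b' e} →
                   InducedMatching₃ m (a , b) (a' , b') e → Mid m a → Mid m a' → ⊥
middle-pair-left {a = a} {a' = a'} M@((_ , a'b' , _) , (¬ab' , _) , _) ma ma' with <-cmp a a'
... | tri< a<a' _ _ = ordered-middle-pair ma ma' a<a' M
... | tri≈ _ refl _ = ¬ab' a'b'
... | tri> _ _ a'<a = ordered-middle-pair ma' ma a'<a (InducedMatching₃-swap₀₁ M)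

middle-pair-right : ∀ {m a b a' b' e} →
                    InducedMatching₃ m (a , b) (a' , b') e → Mid m b → Mid m b' → ⊥
middle-pair-right M = middle-pair-left (InducedMatching₃-transpose M)

-- Each edge has an end in the middle; two of the three edges have it on the same side.
¬InducedMatching₃ : ∀ {m e₀ e₁ e₂} → ¬ InducedMatching₃ m e₀ e₁ e₂
¬InducedMatching₃ M@((A₀ , A₁ , A₂) , _) with proj₂ A₀ | proj₂ A₁ | proj₂ A₂
... | inj₁ m₀ | inj₁ m₁ | _       = middle-pair-left M m₀ m₁
... | inj₂ m₀ | inj₂ m₁ | _       = middle-pair-right M m₀ m₁
... | inj₁ m₀ | inj₂ _  | inj₁ m₂ = middle-pair-left (InducedMatching₃-swap₁₂ M) m₀ m₂
... | inj₂ m₀ | inj₁ _  | inj₂ m₂ = middle-pair-right (InducedMatching₃-swap₁₂ M) m₀ m₂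
... | inj₁ _  | inj₂ m₁ | inj₂ m₂ = middle-pair-right (InducedMatching₃-rotate M) m₁ m₂
... | inj₂ _  | inj₁ m₁ | inj₁ m₂ = middle-pair-left (InducedMatching₃-rotate M) m₁ m₂

-- All positions ≤ m+1 get class 0 and all positions ≥ 2m+2 get class m+1; within each of
-- these two groups the neighbourhoods form a chain.
class : ℕ → ℕ → ℕ
class m i = (i ∸ suc m) ⊓ suc m

class-collision : ∀ {m i i'} → i < i' → class m i ≡ class m i' → i' ≤ suc m ⊎ Top m ≤ i
class-collision {m} {i} {i'} i<i' eq with i' ≤? suc m | Top m ≤? i
... | yes i'≤1+m | _      = inj₁ i'≤1+m
... | no _       | yes T≤i = inj₂ T≤i
... | no i'≰1+m  | no T≰i = contradiction eq (<⇒≢ (begin-strict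
  class m i     ≤⟨ m⊓n≤m (i ∸ suc m) (suc m) ⟩
  i ∸ suc m     <⟨ ⊓-glb (m<n⇒o<n⇒m∸o<n∸o (suc m) i<i' (≰⇒> i'≰1+m)) (s≤s i∸1+m≤m) ⟩
  class m i'    ∎))
  where
  open ≤-Reasoning
  i∸1+m≤m : i ∸ suc m ≤ m
  i∸1+m≤m = ≤-trans (∸-monoˡ-≤ (suc m) (≤-pred (≰⇒> T≰i))) (≤-reflexive (m+n∸m≡n (suc m) m))

low-neighbourhood-mono : ∀ {m i i' j} → i ≤ i' → i' ≤ suc m → Adj m i j → Adj m i' j
low-neighbourhood-mono {m} {i} {i'} {j} i≤i' i'≤1+m ((i≤j+m , j≤i+m) , mid) =
  (reach mid , ≤-trans j≤i+m (+-monoˡ-≤ m i≤i')) , Sum.map₁ shift mid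
  where
  reach : Mid m i ⊎ Mid m j → i' ≤ j + m
  reach (inj₁ (m<i , _)) = ≤-trans i'≤1+m (≤-trans m<i i≤j+m)
  reach (inj₂ (m<j , _)) = ≤-trans i'≤1+m (≤-trans m<j (m≤m+n j m))
  shift : Mid m i → Mid m i'
  shift (m<i , _) = ≤-trans m<i i≤i' , ≤-trans i'≤1+m (<⇒≤ (1+m<Top m))

high-neighbourhood-antimono : ∀ {m i i' j} → Top m ≤ i → i ≤ i' → Adj m i' j → Adj m i j
high-neighbourhood-antimono {m} {i} {i'} {j} T≤i i≤i' ((i'≤j+m , j≤i'+m) , mid) =
  (≤-trans i≤i' i'≤j+m , reach mid) , Sum.map₁ shift mid
  where
  reach : Mid m i' ⊎ Mid m j → j ≤ i + m
  reach (inj₁ (_ , i'≤T)) = ≤-trans j≤i'+m (+-monoˡ-≤ m (≤-trans i'≤T T≤i))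
  reach (inj₂ (_ , j≤T))  = ≤-trans j≤T (≤-trans T≤i (m≤m+n i m))
  shift : Mid m i' → Mid m i
  shift (_ , i'≤T) = ≤-trans (<⇒≤ (1+m<Top m)) T≤i , ≤-trans i≤i' i'≤T

Adj-left-reach : ∀ {m j} → Mid m (j + m) → Adj m (j + m) j
Adj-left-reach {m} {j} mid = (≤-refl , ≤-trans (m≤m+n j m) (m≤m+n (j + m) m)) , inj₁ mid

Adj-right-reach : ∀ {m i} → Mid m i → Adj m i (i + m)
Adj-right-reach {m} {i} mid = (≤-trans (m≤m+n i m) (m≤m+n (i + m) m) , ≤-refl) , inj₁ mid

¬Adj-beyond-left : ∀ {m j j'} → j < j' → ¬ Adj m (j' + m) j
¬Adj-beyond-left {m} {j} {j'} j<j' ((j'+m≤j+m , _) , _) = <⇒≱ j<j' (+-cancelʳ-≤ m j' j j'+m≤j+m)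

¬Adj-beyond-right : ∀ {m i i'} → i' < i → ¬ Adj m i' (i + m)
¬Adj-beyond-right {m} {i} {i'} i'<i ((_ , i+m≤i'+m) , _) = <⇒≱ i'<i (+-cancelʳ-≤ m i i' i+m≤i'+m)

2*[2+m]∸2≡Top : ∀ m → 2 * (2 + m) ∸ 2 ≡ Top m
2*[2+m]∸2≡Top m = cong (_∸ 2) (double m)
  where
  double : ∀ n → 2 * (2 + n) ≡ 2 + (2 + (n + n))
  double = solve-∀

3*[2+m]∸4≡ : ∀ m → 3 * (2 + m) ∸ 4 ≡ 2 + (m + m + m)
3*[2+m]∸4≡ m = cong (_∸ 4) (triple m)
  where
  triple : ∀ n → 3 * (2 + n) ≡ 4 + (2 + (n + n + n))
  triple = solve-∀

Mid-reflects : ∀ m i → Reflects (Mid m i) (inMid (2 + m) i)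
Mid-reflects m i = ≤ᵇ-reflects-≤ (suc m) i ×-reflects
  subst (λ t → Reflects (i ≤ t) (i ≤ᵇ 2 * (2 + m) ∸ 2)) (2*[2+m]∸2≡Top m) (≤ᵇ-reflects-≤ i _)

Vertex : ℕ → Set
Vertex m = Fin (nX (D (2 + m)))

pos : ∀ {n} → Fin n → ℕ
pos x = suc (toℕ x)

D-reflects-Adj : ∀ m (x y : Vertex m) → Reflects (Adj m (pos x) (pos y)) (E (D (2 + m)) x y)
D-reflects-Adj m x y = Reflects-⇔ (∣m-n∣≤o⇔ (pos x) (pos y) m ×-⇔ ⇔-id _)
  (≤ᵇ-reflects-≤ _ m ×-reflects (Mid-reflects m (pos x) ⊎-reflects Mid-reflects m (pos y)))

D-symmetric : ∀ k x y → E (D k) x y ≡ E (D k) y x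
D-symmetric k x y =
  cong₂ _∧_ (cong (_≤ᵇ k ∸ 2) (∣-∣-comm (pos x) (pos y)))
            (∨-comm (inMid k (pos x)) (inMid k (pos y)))

module _ (m : ℕ) where

  private
    G : BGraph
    G = D (2 + m)

  Adj⇒edge : ∀ {x y} → Adj m (pos x) (pos y) → E G x y ≡ true
  Adj⇒edge {x} {y} = reflected⇒true (D-reflects-Adj m x y)

  edge⇒Adj : ∀ {x y} → E G x y ≡ true → Adj m (pos x) (pos y)
  edge⇒Adj {x} {y} = true⇒reflected (D-reflects-Adj m x y)

  non-edge⇒¬Adj : ∀ {x y} → E G x y ≡ false → ¬ Adj m (pos x) (pos y)
  non-edge⇒¬Adj {x} {y} = false⇒¬reflected (D-reflects-Adj m x y)

  D-convex : ConvexY G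
  D-convex x y₁≤y₂ y₂≤y₃ e₁ e₃ =
    Adj⇒edge (Adj-convex (edge⇒Adj e₁) (edge⇒Adj e₃) (s≤s y₁≤y₂) (s≤s y₂≤y₃))

  -- An induced C₆ of the mirror is an induced matching x₀y₂, x₁y₀, x₂y₁ of D_k.
  mir-D-has-no-C₆ : ¬ InducedCycle (mir G) 0
  mir-D-has-no-C₆ cycle = ¬InducedMatching₃
    ((adj i₀ , adj i₁ , adj i₂) ,
     (¬adj-here i₀ , ¬adj-next i₁) , (¬adj-next i₀ , ¬adj-here i₂) , (¬adj-here i₁ , ¬adj-next i₂))
    where
    open InducedCycleFacts (mir G) cycle
    i₀ i₁ i₂ : Fin 3
    i₀ = fzero
    i₁ = fsuc fzero
    i₂ = fsuc (fsuc fzero)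
    adj : ∀ i → Adj m (pos (xs i)) (pos (ys (next (next i))))
    adj i = edge⇒Adj (not-injective {y = true} (non-edge (next²-≢ i) (next-≢ (next i))))
    ¬adj-here : ∀ i → ¬ Adj m (pos (xs i)) (pos (ys i))
    ¬adj-here i = non-edge⇒¬Adj (not-injective {y = false} (edge-here i))
    ¬adj-next : ∀ i → ¬ Adj m (pos (xs i)) (pos (ys (next i)))
    ¬adj-next i = non-edge⇒¬Adj (not-injective {y = false} (edge-next i))

  D-ACB : ACB G
  D-ACB = convex⇒chordalBipartite D-convex , mir-chordal
    where
    mir-chordal : ChordalBipartite (mir G)
    mir-chordal zero    = mir-D-has-no-C₆
    mir-chordal (suc j) = convex⇒mir-has-no-long-cycle D-convex j

  vertex : ∀ v → v < 2 + (m + m + m) → Vertex m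
  vertex v v< = fromℕ< (subst (v <_) (sym (3*[2+m]∸4≡ m)) v<)

  toℕ-vertex : ∀ v (v< : v < 2 + (m + m + m)) → toℕ (vertex v v<) ≡ v
  toℕ-vertex v v< = toℕ-fromℕ< _

  ¬NSub-witness : ∀ {x x' i i'} v (v< : v < 2 + (m + m + m)) → pos x ≡ i → pos x' ≡ i' →
                  Adj m i (suc v) → ¬ Adj m i' (suc v) → ¬ NSub G x x'
  ¬NSub-witness {x} {x'} v v< refl refl adj ¬adj sub = ¬adj (subst (Adj m (pos x')) y-at x'y)
    where
    y : Vertex m
    y = vertex v v<
    y-at : pos y ≡ suc v
    y-at = cong suc (toℕ-vertex v v<)
    x'y : Adj m (pos x') (pos y)
    x'y = edge⇒Adj (sub y (Adj⇒edge (subst (Adj m (pos x)) (sym y-at) adj)))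

  private
    a≤1+m : (a : Fin (2 + m)) → toℕ a ≤ suc m
    a≤1+m a = ≤-pred (toℕ<n a)

    a+m+m< : (a : Fin (2 + m)) → toℕ a + m + m < 2 + (m + m + m)
    a+m+m< a = s≤s (+-monoˡ-≤ m (+-monoˡ-≤ m (a≤1+m a)))

    a+m< : (a : Fin (2 + m)) → toℕ a + m < 2 + (m + m + m)
    a+m< a = ≤-<-trans (m≤m+n (toℕ a + m) m) (a+m+m< a)

    a< : (a : Fin (2 + m)) → toℕ a < 2 + (m + m + m)
    a< a = ≤-<-trans (m≤m+n (toℕ a) m) (a+m< a)

  middle : Fin (2 + m) → Vertex m
  middle a = vertex (toℕ a + m) (a+m< a)

  pos-middle : ∀ a → pos (middle a) ≡ suc (toℕ a) + m
  pos-middle a = cong suc (toℕ-vertex _ (a+m< a))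

  middle-Mid : ∀ a → Mid m (suc (toℕ a) + m)
  middle-Mid a = s≤s (m≤n+m m (toℕ a)) , s≤s (+-monoˡ-≤ m (a≤1+m a))

  middle-injective : ∀ {a b} → middle a ≡ middle b → a ≡ b
  middle-injective {a} {b} eq = toℕ-injective (+-cancelʳ-≡ m _ _ (suc-injective (begin
    suc (toℕ a) + m  ≡⟨ pos-middle a ⟨
    pos (middle a)   ≡⟨ cong pos eq ⟩
    pos (middle b)   ≡⟨ pos-middle b ⟩
    suc (toℕ b) + m  ∎)))
    where open ≡-Reasoning

  -- Of two middle vertices x_i, x_i' with i < i', only x_i sees y_{i-m},
  -- and only x_i' sees y_{i'+m}.
  middle-incomparable : ∀ a b → a ≢ b → ¬ NSub G (middle a) (middle b)
  middle-incomparable a b a≢b with <-cmp (toℕ a) (toℕ b)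
  ... | tri< a<b _ _ = ¬NSub-witness (toℕ a) (a< a) (pos-middle a) (pos-middle b)
                         (Adj-left-reach (middle-Mid a)) (¬Adj-beyond-left (s≤s a<b))
  ... | tri≈ _ a≡b _ = contradiction (toℕ-injective a≡b) a≢b
  ... | tri> _ _ b<a = ¬NSub-witness (toℕ a + m + m) (a+m+m< a) (pos-middle a) (pos-middle b)
                         (Adj-right-reach (middle-Mid a))
                         (¬Adj-beyond-right (s≤s (+-monoˡ-< m b<a)))

  class-of : Vertex m → Fin (2 + m)
  class-of x = fromℕ< (s≤s (m⊓n≤n (pos x ∸ suc m) (suc m)))

  ordered-same-class⇒comparable : ∀ {x x'} → pos x < pos x' → class m (pos x) ≡ class m (pos x') →
                                  NSub G x x' ⊎ NSub G x' x
  ordered-same-class⇒comparable x<x' eq with class-collision x<x' eq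
  ... | inj₁ low  = inj₁ λ _ e → Adj⇒edge (low-neighbourhood-mono (<⇒≤ x<x') low (edge⇒Adj e))
  ... | inj₂ high = inj₂ λ _ e → Adj⇒edge (high-neighbourhood-antimono high (<⇒≤ x<x') (edge⇒Adj e))

  class-of-≡ : ∀ {x x'} → class-of x ≡ class-of x' → class m (pos x) ≡ class m (pos x')
  class-of-≡ eq = trans (sym (toℕ-fromℕ< _)) (trans (cong toℕ eq) (toℕ-fromℕ< _))

  same-class⇒comparable : ∀ x x' → class-of x ≡ class-of x' → NSub G x x' ⊎ NSub G x' x
  same-class⇒comparable x x' eq with <-cmp (toℕ x) (toℕ x')
  ... | tri< x<x' _ _ = ordered-same-class⇒comparable (s≤s x<x') (class-of-≡ eq)
  ... | tri≈ _ x≡x' _ = inj₁ λ y → subst (λ z → E G z y ≡ true) (toℕ-injective x≡x')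
  ... | tri> _ _ x'<x = Sum.swap (ordered-same-class⇒comparable (s≤s x'<x) (sym (class-of-≡ eq)))

  incomparable-family-size≤ : ∀ s (f : Fin s → Vertex m) → IncomparableX G s f → s ≤ 2 + m
  incomparable-family-size≤ s f (_ , incomparable) = injective⇒≤ class-injective
    where
    class-injective : ∀ {a b} → class-of (f a) ≡ class-of (f b) → a ≡ b
    class-injective {a} {b} eq with a ≟ᶠ b
    ... | yes a≡b = a≡b
    ... | no a≢b  = ⊥-elim ([ incomparable a b a≢b , incomparable b a (a≢b ∘ sym) ]′
                              (same-class⇒comparable (f a) (f b) eq))

  D-NablaX : NablaX≡ G (2 + m)
  D-NablaX = (middle , middle-injective , middle-incomparable) , incomparable-family-size≤

theorem3 : (k : ℕ) → 2 ≤ k → ACB (D k) × NablaX≡ (D k) k × NablaY≡ (D k) k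
theorem3 (suc (suc m)) (s≤s (s≤s z≤n)) =
  D-ACB m , D-NablaX m , NablaX≡-cong (D-symmetric (2 + m)) (D-NablaX m)
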